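{- Every polymorphism $f$ of $(\mathbf{LO}_2,\mathbf{LO}_3)$ has a saturation. Moreover, if $f$ has arity at least 7 and no small 2-sets, then $f$ has a pure saturation.
   Context: $[n]=\{1,\dots,n\}$. $\mathrm{LO}_3\subseteq\{0,1,2\}^3$ is the set of triples whose maximum entry occurs in exactly one coordinate. Identify $X\subseteq[n]$ with the 0/1 tuple having 1 exactly in positions of $X$. $f:\{0,1\}^n\to\{0,1,2\}$ is a polymorphism of $(\mathbf{LO}_2,\mathbf{LO}_3)$ iff for every ordered partition $(X,Y,Z)$ of $[n]$ into three (possibly empty) parts, $(f(X),f(Y),f(Z))\in\mathrm{LO}_3$. $X$ is an $i$-set if $f(X)=i$, a boolean set if $f(X)\in\{0,1\}$; a small 2-set is a 2-set with at most three elements. $f$ is upwards closed if every superset of a 2-set is a 2-set; saturated if it is upwards closed and for every $X\subseteq[n]$, $X$ or $[n]\setminus X$ is a 2-set. A saturated $n$-ary polymorphism $g$ is a saturation of $f$ if there is a sequence $f=f_1,\dots,f_l=g$ of $n$-ary polymorphisms of $(\mathbf{LO}_2,\mathbf{LO}_3)$ in which each $f_i$ is obtained from $f_{i-1}$ by changing the value at a single boolean set to 2; it is a pure saturation if moreover $g$ has no small 2-sets. -}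

module Defs where

open import Data.Nat using (ℕ; _≤_; _<_)
open import Data.Fin using (Fin; zero; suc; toℕ)
open import Data.Fin.Subset using (Subset; _∩_; _∪_; ∁; _⊆_; ∣_∣) renaming (⊥ to ∅; ⊤ to Full)
open import Data.Product using (Σ; _×_; ∃-syntax)
open import Data.Sum using (_⊎_)
open import Data.Empty using (⊥)
open import Relation.Binary.PropositionalEquality using (_≡_; _≢_)

𝟎 𝟏 𝟐 : Fin 3
𝟎 = zero
𝟏 = suc zero
𝟐 = suc (suc zero)

LO3 : Fin 3 → Fin 3 → Fin 3 → Set
LO3 a b c =
  (toℕ b < toℕ a × toℕ c < toℕ a)
  ⊎ (toℕ a < toℕ b × toℕ c < toℕ b)
  ⊎ (toℕ a < toℕ c × toℕ b < toℕ c)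

IsPartition3 : ∀ {n} → Subset n → Subset n → Subset n → Set
IsPartition3 X Y Z =
  (X ∩ Y ≡ ∅) × (X ∩ Z ≡ ∅) × (Y ∩ Z ≡ ∅) × (X ∪ Y ∪ Z ≡ Full)

Fun : ℕ → Set
Fun n = Subset n → Fin 3

IsPolymorphism : ∀ {n} → Fun n → Set
IsPolymorphism {n} f =
  (X Y Z : Subset n) → IsPartition3 X Y Z → LO3 (f X) (f Y) (f Z)

IsBoolean : ∀ {n} → Fun n → Subset n → Set
IsBoolean f X = (f X ≡ 𝟎) ⊎ (f X ≡ 𝟏)

NoSmall2Sets : ∀ {n} → Fun n → Set
NoSmall2Sets {n} f = (X : Subset n) → f X ≡ 𝟐 → ∣ X ∣ ≤ 3 → ⊥

UpwardsClosed : ∀ {n} → Fun n → Set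
UpwardsClosed {n} f = (X Y : Subset n) → X ⊆ Y → f X ≡ 𝟐 → f Y ≡ 𝟐

Saturated : ∀ {n} → Fun n → Set
Saturated {n} f = UpwardsClosed f × ((X : Subset n) → (f X ≡ 𝟐) ⊎ (f (∁ X) ≡ 𝟐))

Step : ∀ {n} → Fun n → Fun n → Set
Step {n} f g = ∃[ X ] (IsBoolean f X × g X ≡ 𝟐 × ((Y : Subset n) → Y ≢ X → g Y ≡ f Y))

-- a sequence f = f_1 , ... , f_l = g of polymorphisms, each obtained from
-- the previous by a Step (the first one, f, is assumed a polymorphism separately)
data StepSeq {n} : Fun n → Fun n → Set where
  done : ∀ {f} → StepSeq f f
  step : ∀ {f h g} → IsPolymorphism h → Step f h → StepSeq h g → StepSeq f g

IsSaturationOf : ∀ {n} → Fun n → Fun n → Set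
IsSaturationOf f g = IsPolymorphism g × Saturated g × StepSeq f g

IsPureSaturationOf : ∀ {n} → Fun n → Fun n → Set
IsPureSaturationOf f g = IsSaturationOf f g × NoSmall2Sets g

-- Two 2-sets of a polymorphism always intersect: two disjoint ones extend to a
-- partition on which the value 2 occurs twice.  Hence if a boolean set X meets
-- every 2-set, the other parts of any partition containing X are boolean, and X
-- may be turned into a 2-set.  Doing this greedily along one pass over all
-- subsets, but only for admissible X (the nonempty ones, or those of size at
-- least 4 for a pure saturation), leaves every admissible boolean set disjoint
-- from some 2-set; this persists because 2-sets are never removed.  The result
-- is saturated when supersets of 2-sets are admissible and one of X, ∁ X always
-- is: a boolean superset of a 2-set X would avoid a 2-set, which then avoids X;
-- and a 2-set disjoint from an admissible boolean X lies inside ∁ X.  For sets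
-- of size at least 4 the latter condition is where n ≥ 7 is needed.
module Submission where

open import Defs
open import Data.Nat using (ℕ; zero; suc; _≤_; _<_; z≤n; s≤s; _∸_; _≤?_)
open import Data.Nat.Properties
  using (<-irrefl; <⇒≱; n≮0; ≤-trans; ≤-pred; ≰⇒>; ≤⇒≯; ∸-monoˡ-≤; ∸-monoʳ-≤; module ≤-Reasoning)
open import Data.Bool using (true; false) renaming (_≟_ to _≟ᵇ_)
open import Data.Vec using ([]; _∷_)
open import Data.Vec.Properties using (≡-dec)
open import Data.Fin using (Fin; zero; suc; toℕ)
open import Data.Fin.Properties using (toℕ<n) renaming (_≟_ to _≟ᶠ_)
open import Data.Fin.Subset using (Subset; _∩_; _∪_; ∁; _⊆_; _∈_; _∉_; ∣_∣) renaming (⊥ to ∅)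
open import Data.Fin.Subset.Properties
  using (∩-comm; ∪-assoc; ∉⊥; ⊆-antisym; ⊆-min; Empty-unique; ∩-idem; x∈p∩q⁺; x∈p∩q⁻; x∈p∪q⁺;
         x∈p⇒x∉∁p; x∉p⇒x∈∁p; p∪∁p≡⊤; p⊆q⇒∣p∣≤∣q∣; ∣∁p∣≡n∸∣p∣; ∣⊥∣≡0;
         anySubset?; ∪-∩-booleanAlgebra)
import Algebra.Lattice.Properties.BooleanAlgebra as BooleanAlgebra
open import Data.List using (List; []; _∷_; map; _++_; foldl)
open import Data.List.Membership.Propositional using () renaming (_∈_ to _∈ₗ_)
open import Data.List.Membership.Propositional.Properties using (∈-map⁺; ∈-++⁺ˡ; ∈-++⁺ʳ)
open import Data.List.Relation.Unary.Any using (here; there)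
open import Data.Product using (_×_; ∃-syntax; _,_)
open import Data.Sum using (_⊎_; inj₁; inj₂; [_,_]′)
open import Data.Empty using (⊥-elim)
open import Function using (id; _∘_)
open import Relation.Nullary using (¬_; Dec; yes; no; ¬?)
open import Relation.Nullary.Decidable using (decidable-stable; _×-dec_)
open import Relation.Binary.Definitions using (DecidableEquality)
open import Relation.Binary.PropositionalEquality

infix 4 _≟ₛ_
_≟ₛ_ : ∀ {n} → DecidableEquality (Subset n)
_≟ₛ_ = ≡-dec _≟ᵇ_

∁-involutive : ∀ {n} (X : Subset n) → ∁ (∁ X) ≡ X
∁-involutive {n} = BooleanAlgebra.¬-involutive (∪-∩-booleanAlgebra n)

allSubsets : ∀ n → List (Subset n)
allSubsets zero    = [] ∷ []
allSubsets (suc n) = map (true ∷_) (allSubsets n) ++ map (false ∷_) (allSubsets n)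

∈-allSubsets : ∀ {n} (X : Subset n) → X ∈ₗ allSubsets n
∈-allSubsets []          = here refl
∈-allSubsets (true ∷ X)  = ∈-++⁺ˡ (∈-map⁺ (true ∷_) (∈-allSubsets X))
∈-allSubsets {suc n} (false ∷ X) =
  ∈-++⁺ʳ (map (true ∷_) (allSubsets n)) (∈-map⁺ (false ∷_) (∈-allSubsets X))

module _ {n : ℕ} {W X : Subset n} where

  disjoint⇒∉ : W ∩ X ≡ ∅ → ∀ {x} → x ∈ W → x ∉ X
  disjoint⇒∉ W∩X x∈W x∈X = ∉⊥ (subst (_ ∈_) W∩X (x∈p∩q⁺ (x∈W , x∈X)))

  ∉⇒disjoint : (∀ {x} → x ∈ W → x ∉ X) → W ∩ X ≡ ∅
  ∉⇒disjoint W∌X = Empty-unique λ (x , x∈W∩X) → let x∈W , x∈X = x∈p∩q⁻ W X x∈W∩X in W∌X x∈W x∈X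

  disjoint⇒⊆∁ : W ∩ X ≡ ∅ → W ⊆ ∁ X
  disjoint⇒⊆∁ W∩X = x∉p⇒x∈∁p ∘ disjoint⇒∉ W∩X

  disjoint⇒≢ : X ≢ ∅ → W ∩ X ≡ ∅ → W ≢ X
  disjoint⇒≢ X≢∅ W∩X refl = X≢∅ (trans (sym (∩-idem W)) W∩X)

⊆-disjoint : ∀ {n} {W X Y : Subset n} → X ⊆ Y → W ∩ Y ≡ ∅ → W ∩ X ≡ ∅
⊆-disjoint X⊆Y W∩Y = ∉⇒disjoint λ x∈W x∈X → disjoint⇒∉ W∩Y x∈W (X⊆Y x∈X)

disjoint⇒isPartition3 : ∀ {n} {W X : Subset n} → W ∩ X ≡ ∅ → IsPartition3 X W (∁ (X ∪ W))
disjoint⇒isPartition3 {W = W} {X} W∩X =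
    trans (∩-comm X W) W∩X
  , ∉⇒disjoint (x∈p⇒x∉∁p ∘ x∈p∪q⁺ ∘ inj₁)
  , ∉⇒disjoint (x∈p⇒x∉∁p ∘ x∈p∪q⁺ ∘ inj₂)
  , trans (sym (∪-assoc X W _)) (p∪∁p≡⊤ (X ∪ W))

≢𝟐⇒<2 : ∀ {a} → a ≢ 𝟐 → toℕ a < 2
≢𝟐⇒<2 {zero}             _   = s≤s z≤n
≢𝟐⇒<2 {suc zero}         _   = s≤s (s≤s z≤n)
≢𝟐⇒<2 {suc (suc zero)}   a≢𝟐 = ⊥-elim (a≢𝟐 refl)

≢𝟐⇒boolean : ∀ {a} → a ≢ 𝟐 → a ≡ 𝟎 ⊎ a ≡ 𝟏
≢𝟐⇒boolean {zero}           _   = inj₁ refl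
≢𝟐⇒boolean {suc zero}       _   = inj₂ refl
≢𝟐⇒boolean {suc (suc zero)} a≢𝟐 = ⊥-elim (a≢𝟐 refl)

LO3-𝟐₁ : ∀ {b c} → b ≢ 𝟐 → c ≢ 𝟐 → LO3 𝟐 b c
LO3-𝟐₁ b≢𝟐 c≢𝟐 = inj₁ (≢𝟐⇒<2 b≢𝟐 , ≢𝟐⇒<2 c≢𝟐)

LO3-𝟐₂ : ∀ {a c} → a ≢ 𝟐 → c ≢ 𝟐 → LO3 a 𝟐 c
LO3-𝟐₂ a≢𝟐 c≢𝟐 = inj₂ (inj₁ (≢𝟐⇒<2 a≢𝟐 , ≢𝟐⇒<2 c≢𝟐))

LO3-𝟐₃ : ∀ {a b} → a ≢ 𝟐 → b ≢ 𝟐 → LO3 a b 𝟐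
LO3-𝟐₃ a≢𝟐 b≢𝟐 = inj₂ (inj₂ (≢𝟐⇒<2 a≢𝟐 , ≢𝟐⇒<2 b≢𝟐))

¬LO3-𝟐𝟐 : ∀ c → ¬ LO3 𝟐 𝟐 c
¬LO3-𝟐𝟐 c (inj₁ (2<2 , _))               = <-irrefl refl 2<2
¬LO3-𝟐𝟐 c (inj₂ (inj₁ (2<2 , _)))        = <-irrefl refl 2<2
¬LO3-𝟐𝟐 c (inj₂ (inj₂ (2<c , _)))        = <⇒≱ 2<c (≤-pred (toℕ<n c))

¬LO3-constant : ∀ a → ¬ LO3 a a a
¬LO3-constant a (inj₁ (a<a , _))        = <-irrefl refl a<a
¬LO3-constant a (inj₂ (inj₁ (a<a , _))) = <-irrefl refl a<a
¬LO3-constant a (inj₂ (inj₂ (a<a , _))) = <-irrefl refl a<a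

module _ {n : ℕ} {f : Fun n} (f-poly : IsPolymorphism f) where

  twoSets-intersect : ∀ {W X} → W ∩ X ≡ ∅ → f X ≡ 𝟐 → f W ≢ 𝟐
  twoSets-intersect {W} {X} W∩X fX fW =
    ¬LO3-𝟐𝟐 (f Z) (subst₂ (λ a b → LO3 a b (f Z)) fX fW (f-poly X W Z (disjoint⇒isPartition3 W∩X)))
    where
    Z : Subset n
    Z = ∁ (X ∪ W)

  f∅≢𝟐 : f ∅ ≢ 𝟐
  f∅≢𝟐 f∅ = twoSets-intersect (∩-idem ∅) f∅ f∅

¬polymorphism₀ : (f : Fun 0) → ¬ IsPolymorphism f
¬polymorphism₀ f f-poly = ¬LO3-constant (f []) (f-poly [] [] [] (refl , refl , refl , refl))

update : ∀ {n} → Fun n → Subset n → Fin 3 → Fun n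
update f X v Y with Y ≟ₛ X
... | yes _ = v
... | no  _ = f Y

module _ {n : ℕ} (f : Fun n) (X : Subset n) (v : Fin 3) where

  update-same : update f X v X ≡ v
  update-same with X ≟ₛ X
  ... | yes _   = refl
  ... | no  X≢X = ⊥-elim (X≢X refl)

  update-other : ∀ {Y} → Y ≢ X → update f X v Y ≡ f Y
  update-other {Y} Y≢X with Y ≟ₛ X
  ... | yes Y≡X = ⊥-elim (Y≢X Y≡X)
  ... | no  _   = refl

  update-cases : ∀ Y → (Y ≡ X × update f X v Y ≡ v) ⊎ update f X v Y ≡ f Y
  update-cases Y with Y ≟ₛ X
  ... | yes Y≡X = inj₁ (Y≡X , refl)
  ... | no  _   = inj₂ refl

module _ {n : ℕ} {f : Fun n} {X : Subset n}
         (X≢∅ : X ≢ ∅) (free : ∀ W → W ∩ X ≡ ∅ → f W ≢ 𝟐) where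

  update-𝟐-disjoint : ∀ {W} → W ∩ X ≡ ∅ → update f X 𝟐 W ≢ 𝟐
  update-𝟐-disjoint {W} W∩X =
    subst (_≢ 𝟐) (sym (update-other f X 𝟐 (disjoint⇒≢ X≢∅ W∩X))) (free W W∩X)

  update-𝟐-isPolymorphism : IsPolymorphism f → IsPolymorphism (update f X 𝟐)
  update-𝟐-isPolymorphism f-poly A B C part@(A∩B , A∩C , B∩C , _) with A ≟ₛ X
  ... | yes refl =
    LO3-𝟐₁ (update-𝟐-disjoint (trans (∩-comm B A) A∩B)) (update-𝟐-disjoint (trans (∩-comm C A) A∩C))
  ... | no _ with B ≟ₛ X
  ...   | yes refl = LO3-𝟐₂ (free A A∩B) (update-𝟐-disjoint (trans (∩-comm C B) B∩C))
  ...   | no _ with C ≟ₛ X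
  ...     | yes refl = LO3-𝟐₃ (free A A∩C) (free B B∩C)
  ...     | no _     = f-poly A B C part

-- Greedy saturation relative to a family of admissible sets

_⊑_ : ∀ {n} → Fun n → Fun n → Set
f ⊑ g = ∀ Y → f Y ≡ 𝟐 → g Y ≡ 𝟐

module Greedy {n : ℕ} (Admissible : Subset n → Set)
              (admissible? : ∀ X → Dec (Admissible X))
              (admissible⇒≢∅ : ∀ {X} → Admissible X → X ≢ ∅) where

  Switchable : Fun n → Subset n → Set
  Switchable g X = g X ≢ 𝟐 × Admissible X × (∀ W → W ∩ X ≡ ∅ → g W ≢ 𝟐)

  Blocked : Fun n → Subset n → Set
  Blocked g X = g X ≢ 𝟐 → Admissible X → ∃[ W ] (W ∩ X ≡ ∅ × g W ≡ 𝟐)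

  switchable? : ∀ g X → Switchable g X ⊎ Blocked g X
  switchable? g X with g X ≟ᶠ 𝟐 | admissible? X | anySubset? (λ W → (W ∩ X ≟ₛ ∅) ×-dec (g W ≟ᶠ 𝟐))
  ... | yes gX≡𝟐 | _       | _      = inj₂ λ gX≢𝟐 _ → ⊥-elim (gX≢𝟐 gX≡𝟐)
  ... | no _     | no ¬adm | _      = inj₂ λ _ adm → ⊥-elim (¬adm adm)
  ... | no _     | yes _   | yes W  = inj₂ λ _ _ → W
  ... | no gX≢𝟐  | yes adm | no ¬W  = inj₁ (gX≢𝟐 , adm , λ W W∩X gW → ¬W (W , W∩X , gW))

  Blocked-mono : ∀ {g h X} → g ⊑ h → Blocked g X → Blocked h X
  Blocked-mono {X = X} g⊑h blocked hX≢𝟐 adm with blocked (hX≢𝟐 ∘ g⊑h X) adm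
  ... | W , W∩X , gW = W , W∩X , g⊑h W gW

  trySwitch : Fun n → Subset n → Fun n
  trySwitch g X with switchable? g X
  ... | inj₁ _ = update g X 𝟐
  ... | inj₂ _ = g

  module _ {g : Fun n} {X : Subset n} where

    trySwitch-isPolymorphism : IsPolymorphism g → IsPolymorphism (trySwitch g X)
    trySwitch-isPolymorphism g-poly with switchable? g X
    ... | inj₁ (_ , adm , free) = update-𝟐-isPolymorphism (admissible⇒≢∅ adm) free g-poly
    ... | inj₂ _                = g-poly

    trySwitch-stepSeq : ∀ {h} → IsPolymorphism g → StepSeq (trySwitch g X) h → StepSeq g h
    trySwitch-stepSeq g-poly seq with switchable? g X
    ... | inj₁ (gX≢𝟐 , adm , free) =
      step (update-𝟐-isPolymorphism (admissible⇒≢∅ adm) free g-poly)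
           (X , ≢𝟐⇒boolean gX≢𝟐 , update-same g X 𝟐 , λ Y → update-other g X 𝟐)
           seq
    ... | inj₂ _ = seq

    ⊑-trySwitch : g ⊑ trySwitch g X
    ⊑-trySwitch Y gY with switchable? g X
    ... | inj₂ _ = gY
    ... | inj₁ _ with update-cases g X 𝟐 Y
    ...   | inj₁ (_ , 𝟐≡𝟐) = 𝟐≡𝟐
    ...   | inj₂ unchanged = trans unchanged gY

    trySwitch-blocked : Blocked (trySwitch g X) X
    trySwitch-blocked with switchable? g X
    ... | inj₁ _       = λ gX≢𝟐 _ → ⊥-elim (gX≢𝟐 (update-same g X 𝟐))
    ... | inj₂ blocked = blocked

    trySwitch-new : ∀ {Y} → trySwitch g X Y ≡ 𝟐 → g Y ≡ 𝟐 ⊎ Admissible Y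
    trySwitch-new {Y} gY with switchable? g X
    ... | inj₂ _ = inj₁ gY
    ... | inj₁ (_ , adm , _) with update-cases g X 𝟐 Y
    ...   | inj₁ (refl , _)  = inj₂ adm
    ...   | inj₂ unchanged   = inj₁ (trans (sym unchanged) gY)

  greedy : Fun n → List (Subset n) → Fun n
  greedy = foldl trySwitch

  greedy-isPolymorphism : ∀ {g} xs → IsPolymorphism g → IsPolymorphism (greedy g xs)
  greedy-isPolymorphism []       g-poly = g-poly
  greedy-isPolymorphism {g} (X ∷ xs) g-poly =
    greedy-isPolymorphism xs (trySwitch-isPolymorphism {g} {X} g-poly)

  greedy-stepSeq : ∀ {g} xs → IsPolymorphism g → StepSeq g (greedy g xs)
  greedy-stepSeq []       g-poly = done
  greedy-stepSeq {g} (X ∷ xs) g-poly =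
    trySwitch-stepSeq g-poly (greedy-stepSeq xs (trySwitch-isPolymorphism {g} {X} g-poly))

  ⊑-greedy : ∀ {g} xs → g ⊑ greedy g xs
  ⊑-greedy []       Y gY = gY
  ⊑-greedy {g} (X ∷ xs) Y gY = ⊑-greedy xs Y (⊑-trySwitch {g} {X} Y gY)

  greedy-blocked : ∀ {g X} xs → X ∈ₗ xs → Blocked (greedy g xs) X
  greedy-blocked {g} (X ∷ xs) (here refl) = Blocked-mono (⊑-greedy xs) (trySwitch-blocked {g} {X})
  greedy-blocked (X ∷ xs) (there X∈xs) = greedy-blocked xs X∈xs

  greedy-admissible : ∀ {g} xs → (∀ Y → g Y ≡ 𝟐 → Admissible Y) →
                      ∀ Y → greedy g xs Y ≡ 𝟐 → Admissible Y
  greedy-admissible []       g-adm = g-adm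
  greedy-admissible {g} (X ∷ xs) g-adm =
    greedy-admissible xs λ Y gY → [ g-adm Y , id ]′ (trySwitch-new {g} {X} gY)

  module _ {g : Fun n} (g-poly : IsPolymorphism g) (blocked : ∀ X → Blocked g X)
           (g-adm : ∀ X → g X ≡ 𝟐 → Admissible X)
           (admissible-⊆ : ∀ {X Y} → X ⊆ Y → Admissible X → Admissible Y) where

    blocked⇒upwardsClosed : UpwardsClosed g
    blocked⇒upwardsClosed X Y X⊆Y gX = decidable-stable (g Y ≟ᶠ 𝟐) λ gY≢𝟐 →
      let W , W∩Y , gW = blocked Y gY≢𝟐 (admissible-⊆ X⊆Y (g-adm X gX))
      in  twoSets-intersect g-poly (⊆-disjoint X⊆Y W∩Y) gX gW

    blocked⇒f∁≡𝟐 : ∀ {X} → Admissible X → g X ≢ 𝟐 → g (∁ X) ≡ 𝟐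
    blocked⇒f∁≡𝟐 {X} adm gX≢𝟐 =
      let W , W∩X , gW = blocked X gX≢𝟐 adm
      in  blocked⇒upwardsClosed W (∁ X) (disjoint⇒⊆∁ W∩X) gW

    blocked⇒saturated : (∀ X → Admissible X ⊎ Admissible (∁ X)) → Saturated g
    blocked⇒saturated admissible-∁ = blocked⇒upwardsClosed , complement
      where
      complement : ∀ X → g X ≡ 𝟐 ⊎ g (∁ X) ≡ 𝟐
      complement X with g X ≟ᶠ 𝟐 | admissible-∁ X
      ... | yes gX    | _         = inj₁ gX
      ... | no  gX≢𝟐  | inj₁ adm  = inj₂ (blocked⇒f∁≡𝟐 adm gX≢𝟐)
      ... | no  gX≢𝟐  | inj₂ adm∁ = inj₂ (decidable-stable (g (∁ X) ≟ᶠ 𝟐) λ g∁X≢𝟐 →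
        gX≢𝟐 (subst (λ Z → g Z ≡ 𝟐) (∁-involutive X) (blocked⇒f∁≡𝟐 adm∁ g∁X≢𝟐)))

  saturate : Fun n → Fun n
  saturate f = greedy f (allSubsets n)

  saturate-admissible : ∀ {f} → (∀ X → f X ≡ 𝟐 → Admissible X) →
                        ∀ X → saturate f X ≡ 𝟐 → Admissible X
  saturate-admissible = greedy-admissible (allSubsets n)

  saturate-isSaturation : ∀ {f} → IsPolymorphism f →
    (∀ X → f X ≡ 𝟐 → Admissible X) →
    (∀ {X Y} → X ⊆ Y → Admissible X → Admissible Y) →
    (∀ X → Admissible X ⊎ Admissible (∁ X)) →
    IsSaturationOf f (saturate f)
  saturate-isSaturation f-poly f-adm admissible-⊆ admissible-∁ =
    g-poly , blocked⇒saturated g-poly blocked (saturate-admissible f-adm) admissible-⊆ admissible-∁ ,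
    greedy-stepSeq (allSubsets n) f-poly
    where
    g-poly : IsPolymorphism (saturate _)
    g-poly = greedy-isPolymorphism (allSubsets n) f-poly

    blocked : ∀ X → Blocked (saturate _) X
    blocked X = greedy-blocked (allSubsets n) (∈-allSubsets X)

module NonemptySets {n : ℕ} = Greedy {n} (_≢ ∅) (λ X → ¬? (X ≟ₛ ∅)) id

⊆-≢∅ : ∀ {n} {X Y : Subset n} → X ⊆ Y → X ≢ ∅ → Y ≢ ∅
⊆-≢∅ {X = X} X⊆Y X≢∅ refl = X≢∅ (⊆-antisym X⊆Y (⊆-min X))

≢∅⊎∁≢∅ : ∀ {n} (X : Subset (suc n)) → X ≢ ∅ ⊎ ∁ X ≢ ∅
≢∅⊎∁≢∅ X with X ≟ₛ ∅
... | yes refl = inj₂ λ ()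
... | no  X≢∅  = inj₁ X≢∅

saturation-exists : ∀ {n} (f : Fun n) → IsPolymorphism f → ∃[ g ] IsSaturationOf f g
saturation-exists {zero}  f f-poly = ⊥-elim (¬polymorphism₀ f f-poly)
saturation-exists {suc n} f f-poly =
  saturate f , saturate-isSaturation f-poly (λ { X fX refl → f∅≢𝟐 f-poly fX }) ⊆-≢∅ ≢∅⊎∁≢∅
  where open NonemptySets

Large : ∀ {n} → Subset n → Set
Large X = 4 ≤ ∣ X ∣

large⇒≢∅ : ∀ {n} {X : Subset n} → Large X → X ≢ ∅
large⇒≢∅ {n} large refl = n≮0 (subst (4 ≤_) (∣⊥∣≡0 n) large)

⊆-large : ∀ {n} {X Y : Subset n} → X ⊆ Y → Large X → Large Y
⊆-large X⊆Y large = ≤-trans large (p⊆q⇒∣p∣≤∣q∣ X⊆Y)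

module LargeSets {n : ℕ} = Greedy {n} Large (λ X → 4 ≤? ∣ X ∣) large⇒≢∅

large⊎∁large : ∀ {n} → 7 ≤ n → (X : Subset n) → Large X ⊎ Large (∁ X)
large⊎∁large {n} 7≤n X with 4 ≤? ∣ X ∣
... | yes large = inj₁ large
... | no ¬large = inj₂ (begin
  4            ≤⟨ ∸-monoˡ-≤ 3 7≤n ⟩
  n ∸ 3        ≤⟨ ∸-monoʳ-≤ n (≤-pred (≰⇒> ¬large)) ⟩
  n ∸ ∣ X ∣    ≡⟨ ∣∁p∣≡n∸∣p∣ X ⟨
  ∣ ∁ X ∣      ∎)
  where open ≤-Reasoning

pureSaturation-exists : ∀ {n} (f : Fun n) → IsPolymorphism f → 7 ≤ n → NoSmall2Sets f →
                        ∃[ g ] IsPureSaturationOf f g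
pureSaturation-exists f f-poly 7≤n f-pure =
  saturate f , saturate-isSaturation f-poly f-large ⊆-large (large⊎∁large 7≤n) , g-pure
  where
  open LargeSets

  f-large : ∀ X → f X ≡ 𝟐 → Large X
  f-large X fX with 4 ≤? ∣ X ∣
  ... | yes large = large
  ... | no ¬large = ⊥-elim (f-pure X fX (≤-pred (≰⇒> ¬large)))

  g-pure : NoSmall2Sets (saturate f)
  g-pure X gX small = ≤⇒≯ small (saturate-admissible f-large X gX)

mainTheorem8 : (n : ℕ) (f : Fun n) → IsPolymorphism f →
    (∃[ g ] IsSaturationOf f g)
    × (7 ≤ n → NoSmall2Sets f → ∃[ g ] IsPureSaturationOf f g)
mainTheorem8 n f f-poly = saturation-exists f f-poly , pureSaturation-exists f f-poly
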